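{- Consider the single-machine scheduling problem with uniform linear deterioration and release times, with the makespan objective. The Earliest Completion Time First (ECTF) algorithm achieves an approximation ratio $\rho$ with $\rho\in\left[2,\,3+\frac{1}{\beta}\right]$; in particular, on every instance with deterioration rate $\beta>0$, the makespan $T$ of the ECTF schedule satisfies $T\le\left(3+\frac{1}{\beta}\right)T^*$, where $T^*$ is the optimal makespan.
   Context: Problem: a single machine must process a set $\mathcal{J}=\{1,\ldots,n\}$ of jobs non-preemptively, at most one job at a time. Job $i$ has a release time $r_i\ge 0$ and a fixed processing time $\alpha_i\ge 0$, and there is a common deterioration rate $\beta>0$. If job $i$ starts at time $s_i\ge r_i$, its processing time is $p_i(s_i)=\alpha_i+\beta s_i$, so it completes at $C_i=(1+\beta)s_i+\alpha_i$. A schedule is feasible if jobs do not overlap and $s_i\ge r_i$ for all $i$. The makespan is $T=\max_i C_i$; $T^*$ denotes the minimum makespan over feasible schedules. An algorithm is $\rho$-approximate if it always returns a feasible schedule of makespan at most $\rho T^*$. ECTF algorithm: for a time $t$ and a job $i$, let $\Gamma_i(t)=(1+\beta)\max\{t,r_i\}+\alpha_i$ (the completion time of $i$ if it is the next job started from time $t$ onward). Starting at $t=0$, each time $t$ the machine becomes available, ECTF picks among the jobs not yet scheduled a job $i$ minimizing $\Gamma_i(t)$ and starts it at time $\max\{t,r_i\}$.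
   Formalization: The release times $r_i$, fixed processing times $\alpha_i$, the rate $\beta$, the start times $s_i$ of all schedules, and the ratio $\rho$ in the lower bound are rationals instead of reals. -}

module Defs where

open import Data.Nat using (ℕ; zero; suc)
open import Data.Fin using (Fin; zero; suc; inject₁; toℕ)
open import Data.Rational using (ℚ; 0ℚ; 1ℚ; _+_; _*_; _⊔_; _≤_; _<_; 1/_; positive)
open import Data.Rational.Properties using (pos⇒nonZero)
open import Data.Product using (Σ; _×_; _,_)
open import Data.Sum using (_⊎_)
open import Function.Definitions using (Injective)
open import Relation.Binary.PropositionalEquality using (_≡_; _≢_)

record Instance : Set where
  field
    n    : ℕ
    r    : Fin n → ℚ
    α    : Fin n → ℚ
    β    : ℚ
    r≥0  : ∀ i → 0ℚ ≤ r i
    α≥0  : ∀ i → 0ℚ ≤ α i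
    β>0  : 0ℚ < β

open Instance public

-- A schedule is given by start times s i.
Schedule : Instance → Set
Schedule I = Fin (n I) → ℚ

completion : (I : Instance) → Schedule I → Fin (n I) → ℚ
completion I s i = (1ℚ + β I) * s i + α I i

Feasible : (I : Instance) → Schedule I → Set
Feasible I s =
  (∀ i → r I i ≤ s i) ×
  (∀ i j → i ≢ j → (completion I s i ≤ s j) ⊎ (completion I s j ≤ s i))

-- Maximum of a finite family (0 for the empty family; all completion times are ≥ 0).
maxFin : (m : ℕ) → (Fin m → ℚ) → ℚ
maxFin zero    f = 0ℚ
maxFin (suc m) f = f zero ⊔ maxFin m (λ i → f (suc i))

makespan : (I : Instance) → Schedule I → ℚ
makespan I s = maxFin (n I) (completion I s)

Γ : (I : Instance) → ℚ → Fin (n I) → ℚ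
Γ I t i = (1ℚ + β I) * (t ⊔ r I i) + α I i

availBefore : (m : ℕ) → (Fin m → ℚ) → (Fin m → Fin m) → Fin m → ℚ
availBefore (suc m) C π zero    = 0ℚ
availBefore (suc m) C π (suc k) = C (π (inject₁ k))

-- s is a schedule produced by ECTF (with some tie-breaking): there is a processing
-- order π (a bijection position ↦ job) such that the k-th job starts at
-- max{t_k, r_{π k}} where t_k is the availability time, and it minimises Γ(t_k)
-- among the not-yet-scheduled jobs π m, m ≥ k.
IsECTF : (I : Instance) → Schedule I → Set
IsECTF I s = Σ (Fin (n I) → Fin (n I)) λ π →
  Injective _≡_ _≡_ π ×
  (∀ k → s (π k) ≡ availBefore (n I) (completion I s) π k ⊔ r I (π k)) ×
  (∀ k m → toℕ k Data.Nat.≤ toℕ m →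
     Γ I (availBefore (n I) (completion I s) π k) (π k)
       ≤ Γ I (availBefore (n I) (completion I s) π k) (π m))

ratio : Instance → ℚ
ratio I = (1ℚ + 1ℚ + 1ℚ) + 1/_ (β I) {{pos⇒nonZero (β I) {{positive (β>0 I)}}}}

-- Let σ be any feasible schedule with makespan T*, put L = 1 + β, and let
-- N(c) = #startingFrom c count the jobs that σ starts at time c or later. Jobs never overlap
-- in σ and each one multiplies the clock by at least L, so L ^ N(C*ᵢ) · C*ᵢ ≤ T* for every job i.
--
-- When ECTF picks its k-th job at time t, the unscheduled job iₖ that σ completes first is a
-- candidate, so the k-th completion time is at most max (L t + α iₖ) C*ᵢₖ. The n - k other
-- unscheduled jobs start no earlier than C*ᵢₖ in σ, so L ^ (n - k) · C*ᵢₖ ≤ T*, and unrolling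
-- gives T ≤ T* + Σₖ L ^ (n - k) · α iₖ. Along the ECTF order the potential
-- L ^ (N(C*ᵢ) + 1) · C*ᵢ - L ^ m · α i of the current iₖ never decreases (m is the number of
-- jobs left), which telescopes to β · Σₖ L ^ (n - k) · α iₖ ≤ L T*. Hence T ≤ (2 + 1/β) T*.
module Submission where

open import Defs

open import Algebra.Bundles using (CommutativeRing)
open import Data.Empty using (⊥-elim)
open import Data.Fin using (Fin; zero; suc; inject₁; toℕ; punchOut)
open import Data.Fin.Properties using (any?; punchOut-injective; injective⇒≤)
  renaming (_≟_ to _≟ᶠ_)
open import Data.List using (List; []; _∷_; length; filter; tabulate)
open import Data.List.Properties using (length-filter; filter-all; filter-none)
open import Data.List.Membership.Propositional using (_∈_)
open import Data.List.Membership.Propositional.Properties using (∈-filter⁻; ∈-tabulate⁺)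
open import Data.List.Relation.Binary.Sublist.Propositional using (_⊆_; ⊆-refl)
open import Data.List.Relation.Binary.Sublist.Propositional.Properties
  using (∷ˡ⁻; filter⁺; filter-⊆; length-mono-≤)
open import Data.List.Relation.Unary.All as All using (All; []; _∷_)
open import Data.List.Relation.Unary.All.Properties using () renaming (tabulate⁺ to All-tabulate⁺)
open import Data.List.Relation.Unary.AllPairs using ([]; _∷_)
open import Data.List.Relation.Unary.Any using (here; there)
open import Data.List.Relation.Unary.Unique.Propositional using (Unique)
open import Data.List.Relation.Unary.Unique.Propositional.Properties
  using () renaming (filter⁺ to Unique-filter⁺; tabulate⁺ to Unique-tabulate⁺)
open import Data.Nat as ℕ using (ℕ; zero; suc; z≤n; s≤s)
import Data.Nat.Properties as ℕ
open import Data.Product using (Σ; _×_; _,_; proj₁; proj₂; ∃)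
open import Data.Rational
  using (ℚ; 0ℚ; 1ℚ; ½; _+_; _*_; -_; _-_; _⊔_; _≤_; _<_; 1/_; NonZero; nonNegative; positive)
open import Data.Rational.Properties
open import Data.Rational.Solver using (module +-*-Solver)
open +-*-Solver using (solve; _:+_; _:-_; _:*_; _:=_; con)
open import Data.Sum using (_⊎_; inj₁; inj₂)
open import Data.Unit using (⊤; tt)
open import Function using (_∘_; id)
open import Function.Definitions using (Injective)
open import Relation.Binary.Bundles using (DecTotalOrder)
open import Relation.Binary.Definitions using (DecidableEquality)
open import Relation.Binary.PropositionalEquality
open import Relation.Nullary using (yes; no)
open import Relation.Unary using (Pred; Decidable)
open import Relation.Unary.Properties using (_∪?_)

open import Algebra.Properties.Semiring.Exp (CommutativeRing.semiring +-*-commutativeRing)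
  using (_^_; ^-homo-*)
open import Data.List.Extrema (DecTotalOrder.totalOrder ≤-decTotalOrder)
  using (argmin; argmin-sel; f[argmin]≤f[⊤]; f[argmin]≤f[xs])

private
  variable
    x y z : ℚ

0≤1 : 0ℚ ≤ 1ℚ
0≤1 = nonNegative⁻¹ 1ℚ

p≤p+q : 0ℚ ≤ y → x ≤ x + y
p≤p+q {y} {x} 0≤y = subst (_≤ x + y) (+-identityʳ x) (+-monoʳ-≤ x 0≤y)

p≤q+p : 0ℚ ≤ y → x ≤ y + x
p≤q+p {y} {x} 0≤y = subst (x ≤_) (+-comm x y) (p≤p+q 0≤y)

p<p+q : 0ℚ < y → x < x + y
p<p+q {y} {x} 0<y = subst (_< x + y) (+-identityʳ x) (+-monoʳ-< x 0<y)

p-q≤p : 0ℚ ≤ y → x - y ≤ x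
p-q≤p {y} {x} 0≤y = subst (x - y ≤_) (+-identityʳ x) (+-monoʳ-≤ x (neg-antimono-≤ 0≤y))

0≤p-q : y ≤ x → 0ℚ ≤ x - y
0≤p-q {y} {x} y≤x = subst (_≤ x - y) (+-inverseʳ y) (+-monoˡ-≤ (- y) y≤x)

0≤p*q : 0ℚ ≤ x → 0ℚ ≤ y → 0ℚ ≤ x * y
0≤p*q {x} {y} 0≤x 0≤y =
  nonNegative⁻¹ _ {{nonNeg*nonNeg⇒nonNeg x {{nonNegative 0≤x}} y {{nonNegative 0≤y}}}}

0<p*q : 0ℚ < x → 0ℚ < y → 0ℚ < x * y
0<p*q {x} {y} 0<x 0<y = positive⁻¹ _ {{pos*pos⇒pos x {{positive 0<x}} y {{positive 0<y}}}}

*-monoˡ-≤ : 0ℚ ≤ x → y ≤ z → x * y ≤ x * z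
*-monoˡ-≤ {x} 0≤x = *-monoˡ-≤-nonNeg x {{nonNegative 0≤x}}

*-monoʳ-≤ : 0ℚ ≤ x → y ≤ z → y * x ≤ z * x
*-monoʳ-≤ {x} 0≤x = *-monoʳ-≤-nonNeg x {{nonNegative 0≤x}}

^-nonNeg : 0ℚ ≤ x → ∀ k → 0ℚ ≤ x ^ k
^-nonNeg 0≤x zero    = 0≤1
^-nonNeg 0≤x (suc k) = 0≤p*q 0≤x (^-nonNeg 0≤x k)

1≤^ : 1ℚ ≤ x → ∀ k → 1ℚ ≤ x ^ k
1≤^ 1≤x zero        = ≤-refl
1≤^ {x} 1≤x (suc k) =
  ≤-trans 1≤x (subst (_≤ x * x ^ k) (*-identityʳ x)
    (*-monoˡ-≤ (≤-trans 0≤1 1≤x) (1≤^ 1≤x k)))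

^-monoʳ-≤ : 1ℚ ≤ x → ∀ {m n} → m ℕ.≤ n → x ^ m ≤ x ^ n
^-monoʳ-≤ 1≤x {zero} {n} _ = 1≤^ 1≤x n
^-monoʳ-≤ 1≤x (s≤s m≤n)    = *-monoˡ-≤ (≤-trans 0≤1 1≤x) (^-monoʳ-≤ 1≤x m≤n)

maxFin-ub : ∀ {m} (f : Fin m → ℚ) i → f i ≤ maxFin m f
maxFin-ub {suc m} f zero    = p≤p⊔q (f zero) (maxFin m (f ∘ suc))
maxFin-ub {suc m} f (suc i) = ≤-trans (maxFin-ub (f ∘ suc) i) (p≤q⊔p (f zero) (maxFin m (f ∘ suc)))

maxFin-lub : ∀ {m} {f : Fin m → ℚ} → 0ℚ ≤ x → (∀ i → f i ≤ x) → maxFin m f ≤ x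
maxFin-lub {m = zero}  0≤x _   = 0≤x
maxFin-lub {m = suc m} 0≤x f≤x = ⊔-lub (f≤x zero) (maxFin-lub 0≤x (f≤x ∘ suc))

0≤maxFin : ∀ m (f : Fin m → ℚ) → 0ℚ ≤ maxFin m f
0≤maxFin zero    f = ≤-refl
0≤maxFin (suc m) f = ≤-trans (0≤maxFin m (f ∘ suc)) (p≤q⊔p (f zero) (maxFin m (f ∘ suc)))

module _ {a p q} {A : Set a} {P : Pred A p} {Q : Pred A q} (P? : Decidable P) (Q? : Decidable Q) where

  length-filter-∪ : ∀ xs →
    length (filter (P? ∪? Q?) xs) ℕ.≤ length (filter P? xs) ℕ.+ length (filter Q? xs)
  length-filter-∪ []       = z≤n
  length-filter-∪ (x ∷ xs) with ih ← length-filter-∪ xs | P? x | Q? x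
  ... | yes _ | yes _ = s≤s (ℕ.≤-trans ih (ℕ.+-monoʳ-≤ _ (ℕ.n≤1+n _)))
  ... | yes _ | no  _ = s≤s ih
  ... | no  _ | yes _ = ℕ.≤-trans (s≤s ih) (ℕ.≤-reflexive (sym (ℕ.+-suc _ _)))
  ... | no  _ | no  _ = ih

  length≤filter+filter : ∀ {xs} → (∀ {x} → x ∈ xs → P x ⊎ Q x) →
    length xs ℕ.≤ length (filter P? xs) ℕ.+ length (filter Q? xs)
  length≤filter+filter {xs} cover =
    subst (ℕ._≤ length (filter P? xs) ℕ.+ length (filter Q? xs))
      (cong length (filter-all (P? ∪? Q?) (All.tabulate cover)))
      (length-filter-∪ xs)

module _ {a} {A : Set a} where

  length-filter-≟≤1 : (_≟_ : DecidableEquality A) → ∀ {xs} → Unique xs → ∀ y →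
    length (filter (_≟ y) xs) ℕ.≤ 1
  length-filter-≟≤1 _≟_ {[]}     []         y = z≤n
  length-filter-≟≤1 _≟_ {x ∷ xs} (x∉ ∷ xs!) y with x ≟ y
  ... | yes refl = s≤s (ℕ.≤-reflexive (cong length
                     (filter-none (_≟ x) (All.map (λ x≢w w≡x → x≢w (sym w≡x)) x∉))))
  ... | no  _    = length-filter-≟≤1 _≟_ xs! y

  length-filter-mono-⊆ : ∀ {p} {P : Pred A p} (P? : Decidable P) {xs ys} → xs ⊆ ys →
    length (filter P? xs) ℕ.≤ length (filter P? ys)
  length-filter-mono-⊆ P? xs⊆ys = length-mono-≤ (filter⁺ P? P? (λ { refl Px → Px }) xs⊆ys)

injective⇒surjective : ∀ {m} {f : Fin m → Fin m} → Injective _≡_ _≡_ f → ∀ y → ∃ λ x → f x ≡ y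
injective⇒surjective {suc m} {f} f-injective y with any? (λ x → f x ≟ᶠ y)
... | yes found  = found
... | no  missed = ⊥-elim (ℕ.<-irrefl refl (injective⇒≤ punchOut-f-injective))
  where
  y≢f : ∀ x → y ≢ f x
  y≢f x y≡fx = missed (x , sym y≡fx)

  punchOut-f-injective : Injective _≡_ _≡_ (λ x → punchOut (y≢f x))
  punchOut-f-injective eq = f-injective (punchOut-injective (y≢f _) (y≢f _) eq)

availFrom : ∀ {a} {A : Set a} → (A → ℚ) → ℚ → ∀ {m} → (Fin m → A) → Fin m → ℚ
availFrom C t₀ f zero    = t₀
availFrom C t₀ f (suc k) = C (f (inject₁ k))

availBefore≡availFrom : ∀ {m} (C : Fin m → ℚ) π k → availBefore m C π k ≡ availFrom C 0ℚ π k
availBefore≡availFrom C π zero    = refl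
availBefore≡availFrom C π (suc k) = refl

availFrom-suc : ∀ {a} {A : Set a} (C : A → ℚ) t₀ {m} (f : Fin (suc m) → A) k →
                availFrom C (C (f zero)) (f ∘ suc) k ≡ availFrom C t₀ f (suc k)
availFrom-suc C t₀ f zero    = refl
availFrom-suc C t₀ f (suc k) = refl

module _ (I : Instance) where

  private
    Job : Set
    Job = Fin (n I)

  L : ℚ
  L = 1ℚ + β I

  1≤L : 1ℚ ≤ L
  1≤L = p≤p+q (<⇒≤ (β>0 I))

  0≤L : 0ℚ ≤ L
  0≤L = ≤-trans 0≤1 1≤L

  p≤Lp : 0ℚ ≤ x → x ≤ L * x
  p≤Lp {x} 0≤x = subst (_≤ L * x) (*-identityˡ x) (*-monoʳ-≤ 0≤x 1≤L)

  p<Lp : 0ℚ < x → x < L * x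
  p<Lp {x} 0<x = subst (x <_) (sym (distrib (β I) x)) (p<p+q (0<p*q (β>0 I) 0<x))
    where
    distrib : ∀ b x → (1ℚ + b) * x ≡ x + b * x
    distrib = solve 2 (λ b x → (con 1ℚ :+ b) :* x := x :+ b :* x) refl

  Γ-inflationary : ∀ {t} p → 0ℚ ≤ t → t ≤ Γ I t p
  Γ-inflationary {t} p 0≤t = ≤-trans (p≤p⊔q t (r I p))
    (≤-trans (p≤Lp (≤-trans 0≤t (p≤p⊔q t (r I p)))) (p≤p+q (α≥0 I p)))

  0≤Γ : ∀ {t} p → 0ℚ ≤ t → 0ℚ ≤ Γ I t p
  0≤Γ p 0≤t = ≤-trans 0≤t (Γ-inflationary p 0≤t)

  finish : ℚ → List Job → ℚ
  finish t []       = t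
  finish t (p ∷ ps) = finish (Γ I t p) ps

  finish-inflationary : ∀ {t} ps → 0ℚ ≤ t → t ≤ finish t ps
  finish-inflationary []       0≤t = ≤-refl
  finish-inflationary (p ∷ ps) 0≤t =
    ≤-trans (Γ-inflationary p 0≤t) (finish-inflationary ps (0≤Γ p 0≤t))

  Greedy : ℚ → List Job → Set
  Greedy t []       = ⊤
  Greedy t (p ∷ ps) = All (λ q → Γ I t p ≤ Γ I t q) ps × Greedy (Γ I t p) ps

  data Sequential (s : Schedule I) : ℚ → List Job → Set where
    []  : ∀ {t} → Sequential s t []
    _∷_ : ∀ {t p ps} → s p ≡ t ⊔ r I p → Sequential s (Γ I t p) ps → Sequential s t (p ∷ ps)

  module _ {s : Schedule I} where

    completion≡Γ : ∀ t {p} → s p ≡ t ⊔ r I p → completion I s p ≡ Γ I t p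
    completion≡Γ t {p} starts = cong (λ u → L * u + α I p) starts

    Sequential-release : ∀ {t ps q} → Sequential s t ps → q ∈ ps → r I q ≤ s q
    Sequential-release {t} (starts ∷ _) (here refl) = ≤-trans (p≤q⊔p t _) (≤-reflexive (sym starts))
    Sequential-release (_ ∷ seq) (there q∈) = Sequential-release seq q∈

    Sequential-start : ∀ {t ps q} → Sequential s t ps → 0ℚ ≤ t → q ∈ ps → t ≤ s q
    Sequential-start {t} {q = q} (starts ∷ _) _ (here refl) =
      ≤-trans (p≤p⊔q t (r I q)) (≤-reflexive (sym starts))
    Sequential-start {ps = p ∷ _} (_ ∷ seq) 0≤t (there q∈) =
      ≤-trans (Γ-inflationary p 0≤t) (Sequential-start seq (0≤Γ p 0≤t) q∈)

    Sequential-finish : ∀ {t ps q} → Sequential s t ps → 0ℚ ≤ t → q ∈ ps →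
                        completion I s q ≤ finish t ps
    Sequential-finish {t} {p ∷ ps} (starts ∷ _) 0≤t (here refl) =
      ≤-trans (≤-reflexive (completion≡Γ t starts)) (finish-inflationary ps (0≤Γ p 0≤t))
    Sequential-finish {t} {p ∷ _} (_ ∷ seq) 0≤t (there q∈) = Sequential-finish seq (0≤Γ p 0≤t) q∈

    Sequential-disjoint : ∀ {t ps i j} → Sequential s t ps → 0ℚ ≤ t → i ∈ ps → j ∈ ps → i ≢ j →
                          completion I s i ≤ s j ⊎ completion I s j ≤ s i
    Sequential-disjoint _ _ (here refl) (here refl) i≢j = ⊥-elim (i≢j refl)
    Sequential-disjoint {t} {p ∷ _} (starts ∷ seq) 0≤t (here refl) (there j∈) _ =
      inj₁ (≤-trans (≤-reflexive (completion≡Γ t starts)) (Sequential-start seq (0≤Γ p 0≤t) j∈))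
    Sequential-disjoint {t} {p ∷ _} (starts ∷ seq) 0≤t (there i∈) (here refl) _ =
      inj₂ (≤-trans (≤-reflexive (completion≡Γ t starts)) (Sequential-start seq (0≤Γ p 0≤t) i∈))
    Sequential-disjoint {t} {p ∷ _} (_ ∷ seq) 0≤t (there i∈) (there j∈) i≢j =
      Sequential-disjoint seq (0≤Γ p 0≤t) i∈ j∈ i≢j

    tabulate-ECTF : ∀ {m} (f : Fin m → Job) t₀ →
      (∀ k → s (f k) ≡ availFrom (completion I s) t₀ f k ⊔ r I (f k)) →
      (∀ k k′ → toℕ k ℕ.≤ toℕ k′ →
         let t = availFrom (completion I s) t₀ f k in Γ I t (f k) ≤ Γ I t (f k′)) →
      Greedy t₀ (tabulate f) × Sequential s t₀ (tabulate f)
    tabulate-ECTF {zero}  f t₀ starts greedy = tt , []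
    tabulate-ECTF {suc m} f t₀ starts greedy =
      ( (All-tabulate⁺ (λ k → greedy zero (suc k) z≤n) , subst (λ t → Greedy t _) C₀≡Γ (proj₁ rest))
      , (starts zero ∷ subst (λ t → Sequential s t _) C₀≡Γ (proj₂ rest)))
      where
      C₀≡Γ : completion I s (f zero) ≡ Γ I t₀ (f zero)
      C₀≡Γ = completion≡Γ t₀ (starts zero)
      shift = availFrom-suc (completion I s) t₀ f
      rest = tabulate-ECTF (f ∘ suc) (completion I s (f zero))
        (λ k → trans (starts (suc k)) (cong (_⊔ r I (f (suc k))) (sym (shift k))))
        (λ k k′ k≤k′ → subst (λ t → Γ I t (f (suc k)) ≤ Γ I t (f (suc k′))) (sym (shift k))
                         (greedy (suc k) (suc k′) (s≤s k≤k′)))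

  module _ (σ : Schedule I) (σ-feasible : Feasible I σ) where

    private
      C : Job → ℚ
      C = completion I σ

      T* : ℚ
      T* = makespan I σ

    0≤σ : ∀ z → 0ℚ ≤ σ z
    0≤σ z = ≤-trans (r≥0 I z) (proj₁ σ-feasible z)

    Lσ≤C : ∀ z → L * σ z ≤ C z
    Lσ≤C z = p≤p+q (α≥0 I z)

    α≤C : ∀ z → α I z ≤ C z
    α≤C z = p≤q+p (0≤p*q 0≤L (0≤σ z))

    0≤C : ∀ z → 0ℚ ≤ C z
    0≤C z = ≤-trans (α≥0 I z) (α≤C z)

    C≤T* : ∀ z → C z ≤ T*
    C≤T* = maxFin-ub C

    0≤T* : 0ℚ ≤ T*
    0≤T* = 0≤maxFin (n I) C

    zero-length : ∀ z → C z ≤ σ z → C z ≤ 0ℚ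
    zero-length z C≤σ with 0ℚ <? σ z
    ... | no  σ≯0 = ≤-trans C≤σ (≮⇒≥ σ≯0)
    ... | yes σ>0 = ⊥-elim (<-irrefl refl (<-≤-trans (p<Lp σ>0) (≤-trans (Lσ≤C z) C≤σ)))

    finishes-before : ∀ {w z} → w ≢ z → C w ≤ C z → C w ≤ σ z
    finishes-before {w} {z} w≢z Cw≤Cz with proj₂ σ-feasible w z w≢z
    ... | inj₁ Cw≤σz = Cw≤σz
    ... | inj₂ Cz≤σw = ≤-trans (zero-length w (≤-trans Cw≤Cz Cz≤σw)) (0≤σ z)

    window-bound : ∀ {c b} xs → Unique xs → 0ℚ ≤ c → c ≤ b →
                   (∀ {z} → z ∈ xs → c ≤ σ z) → (∀ {z} → z ∈ xs → C z ≤ b) →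
                   L ^ length xs * c ≤ b
    window-bound xs = window-bound-within (length xs) xs ℕ.≤-refl
      where
      regroup : ∀ l u v c → l * (u * v) * c ≡ v * (l * (u * c))
      regroup = solve 4 (λ l u v c → l :* (u :* v) :* c := v :* (l :* (u :* c))) refl

      -- The other jobs of x ∷ xs finish before x starts or start after x finishes, so x
      -- splits the window into two smaller ones.
      window-bound-within : ∀ k {c b} xs → length xs ℕ.≤ k → Unique xs → 0ℚ ≤ c → c ≤ b →
                            (∀ {z} → z ∈ xs → c ≤ σ z) → (∀ {z} → z ∈ xs → C z ≤ b) →
                            L ^ length xs * c ≤ b
      window-bound-within k {c} [] _ _ _ c≤b _ _ = subst (_≤ _) (sym (*-identityˡ c)) c≤b
      window-bound-within (suc k) {c} {b} (x ∷ xs) (s≤s |xs|≤k) (x∉ ∷ xs!) 0≤c c≤b c≤σ C≤b = begin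
          L ^ suc (length xs) * c
            ≤⟨ *-monoʳ-≤ 0≤c (^-monoʳ-≤ 1≤L (s≤s split-length)) ⟩
          L * L ^ (length before ℕ.+ length after) * c
            ≡⟨ cong (λ u → L * u * c) (^-homo-* L (length before) (length after)) ⟩
          L * (L ^ length before * L ^ length after) * c
            ≡⟨ regroup L (L ^ length before) (L ^ length after) c ⟩
          L ^ length after * (L * (L ^ length before * c))
            ≤⟨ *-monoˡ-≤ (^-nonNeg 0≤L (length after)) (*-monoˡ-≤ 0≤L before-bound) ⟩
          L ^ length after * (L * σ x)
            ≤⟨ *-monoˡ-≤ (^-nonNeg 0≤L (length after)) (Lσ≤C x) ⟩
          L ^ length after * C x
            ≤⟨ after-bound ⟩
          b ∎
        where
        open ≤-Reasoning
        before? = λ w → C w ≤? σ x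
        after?  = λ w → C x ≤? σ w
        before  = filter before? xs
        after   = filter after? xs

        split-length : length xs ℕ.≤ length before ℕ.+ length after
        split-length = length≤filter+filter before? after?
          (λ w∈ → proj₂ σ-feasible _ x (λ w≡x → All.lookup x∉ w∈ (sym w≡x)))

        before-bound : L ^ length before * c ≤ σ x
        before-bound = window-bound-within k before (ℕ.≤-trans (length-filter before? xs) |xs|≤k)
          (Unique-filter⁺ before? xs!) 0≤c (c≤σ (here refl))
          (λ w∈ → c≤σ (there (proj₁ (∈-filter⁻ before? {xs = xs} w∈))))
          (λ w∈ → proj₂ (∈-filter⁻ before? {xs = xs} w∈))

        after-bound : L ^ length after * C x ≤ b
        after-bound = window-bound-within k after (ℕ.≤-trans (length-filter after? xs) |xs|≤k)
          (Unique-filter⁺ after? xs!) (0≤C x) (C≤b (here refl))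
          (λ w∈ → proj₂ (∈-filter⁻ after? {xs = xs} w∈))
          (λ w∈ → C≤b (there (proj₁ (∈-filter⁻ after? {xs = xs} w∈))))

    earliest : Job → List Job → Job
    earliest = argmin C

    earliest-∈ : ∀ p ps → earliest p ps ∈ p ∷ ps
    earliest-∈ p ps with argmin-sel C p ps
    ... | inj₁ ≡p  = here ≡p
    ... | inj₂ ∈ps = there ∈ps

    earliest-≤ : ∀ p ps {z} → z ∈ p ∷ ps → C (earliest p ps) ≤ C z
    earliest-≤ p ps (here refl) = f[argmin]≤f[⊤] {f = C} p ps
    earliest-≤ p ps (there z∈)  = All.lookup (f[argmin]≤f[xs] {f = C} p ps) z∈

    excess : List Job → ℚ
    excess []       = 0ℚ
    excess (p ∷ ps) = L ^ length ps * α I (earliest p ps) + excess ps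

    module _ (U : List Job) (U! : Unique U) where

      startingFrom : ℚ → List Job
      startingFrom c = filter (λ z → c ≤? σ z) U

      #startingFrom : ℚ → ℕ
      #startingFrom c = length (startingFrom c)

      #startingFrom-bound : ∀ x → L ^ #startingFrom (C x) * C x ≤ T*
      #startingFrom-bound x = window-bound (startingFrom (C x)) (Unique-filter⁺ _ U!) (0≤C x) (C≤T* x)
        (λ z∈ → proj₂ (∈-filter⁻ (λ z → C x ≤? σ z) {xs = U} z∈)) (λ {z} _ → C≤T* z)

      #startingFrom-step : ∀ {x y} → x ≢ y → C x ≤ C y →
        L ^ #startingFrom (C x) * C x ≤ L ^ suc (#startingFrom (C y)) * σ y
      #startingFrom-step {x} {y} x≢y Cx≤Cy = begin
          L ^ #startingFrom (C x) * C x
            ≤⟨ *-monoʳ-≤ (0≤C x) (^-monoʳ-≤ 1≤L counted) ⟩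
          L ^ (suc Nʸ ℕ.+ length between) * C x
            ≡⟨ cong (_* C x) (^-homo-* L (suc Nʸ) (length between)) ⟩
          L ^ suc Nʸ * L ^ length between * C x
            ≡⟨ *-assoc (L ^ suc Nʸ) (L ^ length between) (C x) ⟩
          L ^ suc Nʸ * (L ^ length between * C x)
            ≤⟨ *-monoˡ-≤ (^-nonNeg 0≤L (suc Nʸ)) between-bound ⟩
          L ^ suc Nʸ * σ y ∎
        where
        open ≤-Reasoning
        Nʸ = #startingFrom (C y)
        V = startingFrom (C x)
        y-or-later? = (_≟ᶠ y) ∪? (λ z → C y ≤? σ z)
        between? = λ z → C z ≤? σ y
        between = filter between? V

        V-cover : ∀ {z} → z ∈ V → (z ≡ y ⊎ C y ≤ σ z) ⊎ C z ≤ σ y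
        V-cover {z} _ with z ≟ᶠ y
        ... | yes z≡y = inj₁ (inj₁ z≡y)
        ... | no  z≢y with proj₂ σ-feasible z y z≢y
        ...   | inj₁ Cz≤σy = inj₂ Cz≤σy
        ...   | inj₂ Cy≤σz = inj₁ (inj₂ Cy≤σz)

        counted : #startingFrom (C x) ℕ.≤ suc Nʸ ℕ.+ length between
        counted = ℕ.≤-trans (length≤filter+filter y-or-later? between? V-cover)
          (ℕ.+-monoˡ-≤ (length between) (ℕ.≤-trans (length-filter-mono-⊆ y-or-later? (filter-⊆ _ U))
            (ℕ.≤-trans (length-filter-∪ (_≟ᶠ y) (λ z → C y ≤? σ z) U)
              (ℕ.+-monoˡ-≤ Nʸ (length-filter-≟≤1 _≟ᶠ_ U! y)))))

        between-bound : L ^ length between * C x ≤ σ y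
        between-bound = window-bound between (Unique-filter⁺ between? (Unique-filter⁺ _ U!)) (0≤C x)
          (finishes-before x≢y Cx≤Cy)
          (λ z∈ → proj₂ (∈-filter⁻ (λ z → C x ≤? σ z) {xs = U}
                            (proj₁ (∈-filter⁻ between? {xs = V} z∈))))
          (λ z∈ → proj₂ (∈-filter⁻ between? {xs = V} z∈))

      length≤suc#startingFrom : ∀ {i ps} → Unique ps → ps ⊆ U → (∀ {z} → z ∈ ps → C i ≤ C z) →
                                length ps ℕ.≤ suc (#startingFrom (C i))
      length≤suc#startingFrom {i} {ps} ps! ps⊆U i-first =
        ℕ.≤-trans (length≤filter+filter (_≟ᶠ i) (λ z → C i ≤? σ z) cover)
          (ℕ.+-mono-≤ (length-filter-≟≤1 _≟ᶠ_ ps! i)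
                      (length-filter-mono-⊆ (λ z → C i ≤? σ z) ps⊆U))
        where
        cover : ∀ {z} → z ∈ ps → z ≡ i ⊎ C i ≤ σ z
        cover {z} z∈ with z ≟ᶠ i
        ... | yes z≡i = inj₁ z≡i
        ... | no  z≢i = inj₂ (finishes-before (z≢i ∘ sym) (i-first z∈))

      earliest-bound : ∀ p ps → Unique (p ∷ ps) → p ∷ ps ⊆ U → L ^ length ps * C (earliest p ps) ≤ T*
      earliest-bound p ps pps! pps⊆U = ≤-trans
        (*-monoʳ-≤ (0≤C i) (^-monoʳ-≤ 1≤L
          (ℕ.s≤s⁻¹ (length≤suc#startingFrom pps! pps⊆U (earliest-≤ p ps)))))
        (#startingFrom-bound i)
        where i = earliest p ps

      greedy-step : ∀ {t} p ps → Unique (p ∷ ps) → p ∷ ps ⊆ U → All (λ q → Γ I t p ≤ Γ I t q) ps →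
        L ^ length ps * Γ I t p ≤ (L ^ suc (length ps) * t) ⊔ T* + L ^ length ps * α I (earliest p ps)
      greedy-step {t} p ps pps! pps⊆U p-first =
        ≤-trans (*-monoˡ-≤ 0≤Lᵐ Γp≤) (bound (≤-total t (σ i)))
        where
        i = earliest p ps
        Lᵐ = L ^ length ps
        Lᵐ⁺¹ = L ^ suc (length ps)
        0≤Lᵐ = ^-nonNeg 0≤L (length ps)

        Γp≤ : Γ I t p ≤ L * (t ⊔ σ i) + α I i
        Γp≤ = ≤-trans (p-first-in (earliest-∈ p ps))
          (+-monoˡ-≤ (α I i) (*-monoˡ-≤ 0≤L (⊔-monoʳ-≤ t (proj₁ σ-feasible i))))
          where
          p-first-in : ∀ {q} → q ∈ p ∷ ps → Γ I t p ≤ Γ I t q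
          p-first-in (here refl) = ≤-refl
          p-first-in (there q∈)  = All.lookup p-first q∈

        expand : ∀ l u t a → u * (l * t + a) ≡ l * u * t + u * a
        expand = solve 4 (λ l u t a → u :* (l :* t :+ a) := l :* u :* t :+ u :* a) refl

        bound : t ≤ σ i ⊎ σ i ≤ t → Lᵐ * (L * (t ⊔ σ i) + α I i) ≤ (Lᵐ⁺¹ * t) ⊔ T* + Lᵐ * α I i
        bound (inj₁ t≤σ) = begin
          Lᵐ * (L * (t ⊔ σ i) + α I i)
            ≡⟨ cong (λ u → Lᵐ * (L * u + α I i)) (p≤q⇒p⊔q≡q t≤σ) ⟩
          Lᵐ * C i                      ≤⟨ earliest-bound p ps pps! pps⊆U ⟩
          T*                            ≤⟨ p≤q⊔p (Lᵐ⁺¹ * t) T* ⟩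
          (Lᵐ⁺¹ * t) ⊔ T*               ≤⟨ p≤p+q (0≤p*q 0≤Lᵐ (α≥0 I i)) ⟩
          (Lᵐ⁺¹ * t) ⊔ T* + Lᵐ * α I i  ∎
          where open ≤-Reasoning
        bound (inj₂ σ≤t) = begin
          Lᵐ * (L * (t ⊔ σ i) + α I i)
            ≡⟨ cong (λ u → Lᵐ * (L * u + α I i)) (p≥q⇒p⊔q≡p σ≤t) ⟩
          Lᵐ * (L * t + α I i)          ≡⟨ expand L Lᵐ t (α I i) ⟩
          Lᵐ⁺¹ * t + Lᵐ * α I i
            ≤⟨ +-monoˡ-≤ (Lᵐ * α I i) (p≤p⊔q (Lᵐ⁺¹ * t) T*) ⟩
          (Lᵐ⁺¹ * t) ⊔ T* + Lᵐ * α I i  ∎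
          where open ≤-Reasoning

      finish-bound : ∀ t ps → Unique ps → ps ⊆ U → Greedy t ps →
                     finish t ps ≤ (L ^ length ps * t) ⊔ T* + excess ps
      finish-bound t [] _ _ _ = begin
          t                   ≡⟨ *-identityˡ t ⟨
          1ℚ * t              ≤⟨ p≤p⊔q (1ℚ * t) T* ⟩
          (1ℚ * t) ⊔ T*       ≡⟨ +-identityʳ ((1ℚ * t) ⊔ T*) ⟨
          (1ℚ * t) ⊔ T* + 0ℚ  ∎
        where open ≤-Reasoning
      finish-bound t (p ∷ ps) pps!@(_ ∷ ps!) pps⊆U (p-first , greedy) = begin
          finish (Γ I t p) ps
            ≤⟨ finish-bound (Γ I t p) ps ps! (∷ˡ⁻ pps⊆U) greedy ⟩
          (Lᵐ * Γ I t p) ⊔ T* + excess ps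
            ≤⟨ +-monoˡ-≤ (excess ps) (⊔-lub (greedy-step p ps pps! pps⊆U p-first)
                 (≤-trans (p≤q⊔p (Lᵐ⁺¹ * t) T*)
                   (p≤p+q (0≤p*q (^-nonNeg 0≤L (length ps)) (α≥0 I i))))) ⟩
          (Lᵐ⁺¹ * t) ⊔ T* + Lᵐ * α I i + excess ps
            ≡⟨ +-assoc ((Lᵐ⁺¹ * t) ⊔ T*) (Lᵐ * α I i) (excess ps) ⟩
          (Lᵐ⁺¹ * t) ⊔ T* + excess (p ∷ ps) ∎
        where
        open ≤-Reasoning
        i = earliest p ps
        Lᵐ = L ^ length ps
        Lᵐ⁺¹ = L ^ suc (length ps)

      potential : Job → ℕ → ℚ
      potential i m = L ^ suc (#startingFrom (C i)) * C i - L ^ m * α I i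

      potential-nonNeg : ∀ {i m} → m ℕ.≤ suc (#startingFrom (C i)) → 0ℚ ≤ potential i m
      potential-nonNeg {i} {m} m≤ = 0≤p-q (begin
          L ^ m * α I i       ≤⟨ *-monoʳ-≤ (α≥0 I i) (^-monoʳ-≤ 1≤L m≤) ⟩
          L ^ suc Nⁱ * α I i  ≤⟨ *-monoˡ-≤ (^-nonNeg 0≤L (suc Nⁱ)) (α≤C i) ⟩
          L ^ suc Nⁱ * C i    ∎)
        where
        open ≤-Reasoning
        Nⁱ = #startingFrom (C i)

      potential-mono : ∀ {i j m} → C i ≤ C j → m ℕ.≤ suc (#startingFrom (C j)) →
                       potential i m ≤ potential j m
      potential-mono {i} {j} {m} Ci≤Cj m≤ with i ≟ᶠ j
      ... | yes refl = ≤-refl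
      ... | no  i≢j  = begin
          L ^ suc Nⁱ * C i - L ^ m * α I i  ≤⟨ p-q≤p (0≤p*q (^-nonNeg 0≤L m) (α≥0 I i)) ⟩
          L * L ^ Nⁱ * C i                  ≡⟨ *-assoc L (L ^ Nⁱ) (C i) ⟩
          L * (L ^ Nⁱ * C i)                ≤⟨ *-monoˡ-≤ 0≤L (#startingFrom-step i≢j Ci≤Cj) ⟩
          L * (L ^ suc Nʲ * σ j)            ≡⟨ split L (L ^ suc Nʲ) (σ j) (α I j) ⟩
          L ^ suc Nʲ * C j - L ^ suc Nʲ * α I j
            ≤⟨ +-monoʳ-≤ (L ^ suc Nʲ * C j)
                 (neg-antimono-≤ (*-monoʳ-≤ (α≥0 I j) (^-monoʳ-≤ 1≤L m≤))) ⟩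
          L ^ suc Nʲ * C j - L ^ m * α I j  ∎
        where
        open ≤-Reasoning
        Nⁱ = #startingFrom (C i)
        Nʲ = #startingFrom (C j)
        split : ∀ l u s a → l * (u * s) ≡ u * (l * s + a) - u * a
        split = solve 4 (λ l u s a → l :* (u :* s) := u :* (l :* s :+ a) :- u :* a) refl

      excess-potential : ∀ p ps → Unique (p ∷ ps) → p ∷ ps ⊆ U →
        β I * excess (p ∷ ps) + potential (earliest p ps) (length (p ∷ ps)) ≤ L * T*
      excess-potential p [] _ _ = begin
          β I * (1ℚ * α I p + 0ℚ) + (L * L ^ Nᵖ * C p - L * 1ℚ * α I p)
            ≡⟨ simplify (β I) (L ^ Nᵖ) (C p) (α I p) ⟩
          L * (L ^ Nᵖ * C p) - α I p  ≤⟨ p-q≤p (α≥0 I p) ⟩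
          L * (L ^ Nᵖ * C p)          ≤⟨ *-monoˡ-≤ 0≤L (#startingFrom-bound p) ⟩
          L * T*                      ∎
        where
        open ≤-Reasoning
        Nᵖ = #startingFrom (C p)
        simplify : ∀ b u c a →
          b * (1ℚ * a + 0ℚ) + ((1ℚ + b) * u * c - (1ℚ + b) * 1ℚ * a) ≡ (1ℚ + b) * (u * c) - a
        simplify = solve 4 (λ b u c a →
          b :* (con 1ℚ :* a :+ con 0ℚ) :+ ((con 1ℚ :+ b) :* u :* c :- (con 1ℚ :+ b) :* con 1ℚ :* a)
            := (con 1ℚ :+ b) :* (u :* c) :- a) refl
      excess-potential p (q ∷ qs) (_ ∷ qqs!) pqqs⊆U = begin
          β I * (L ^ m * α I i + excess (q ∷ qs)) + (Φⁱ - L * L ^ m * α I i)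
            ≡⟨ telescope (β I) (L ^ m) (α I i) (excess (q ∷ qs)) Φⁱ ⟩
          β I * excess (q ∷ qs) + potential i m
            ≤⟨ +-monoʳ-≤ (β I * excess (q ∷ qs)) (potential-mono Ci≤Cj m≤) ⟩
          β I * excess (q ∷ qs) + potential j m
            ≤⟨ excess-potential q qs qqs! qqs⊆U ⟩
          L * T* ∎
        where
        open ≤-Reasoning
        i = earliest p (q ∷ qs)
        j = earliest q qs
        m = length (q ∷ qs)
        Φⁱ = L ^ suc (#startingFrom (C i)) * C i
        qqs⊆U = ∷ˡ⁻ pqqs⊆U
        Ci≤Cj = earliest-≤ p (q ∷ qs) (there (earliest-∈ q qs))
        m≤ = length≤suc#startingFrom qqs! qqs⊆U (earliest-≤ q qs)
        telescope : ∀ b u a e φ → b * (u * a + e) + (φ - (1ℚ + b) * u * a) ≡ b * e + (φ - u * a)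
        telescope = solve 5 (λ b u a e φ →
          b :* (u :* a :+ e) :+ (φ :- (con 1ℚ :+ b) :* u :* a) := b :* e :+ (φ :- u :* a)) refl

      excess-bound : ∀ ps → Unique ps → ps ⊆ U → β I * excess ps ≤ L * T*
      excess-bound []       _    _     = ≤-trans (≤-reflexive (*-zeroʳ (β I))) (0≤p*q 0≤L 0≤T*)
      excess-bound (p ∷ ps) pps! pps⊆U = ≤-trans
        (p≤p+q (potential-nonNeg (length≤suc#startingFrom pps! pps⊆U (earliest-≤ p ps))))
        (excess-potential p ps pps! pps⊆U)

≤-ratio : ∀ I {T T* e} → 0ℚ ≤ T* → T ≤ T* + e → β I * e ≤ L I * T* → T ≤ ratio I * T*
≤-ratio I {T} {T*} {e} 0≤T* T≤T*+e βe≤LT* = begin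
    T                                 ≤⟨ T≤T*+e ⟩
    T* + e                            ≡⟨ cong (T* +_) e≡β⁻¹[βe] ⟩
    T* + β⁻¹ * (β I * e)              ≤⟨ +-monoʳ-≤ T* (*-monoˡ-≤ 0≤β⁻¹ βe≤LT*) ⟩
    T* + β⁻¹ * ((1ℚ + β I) * T*)      ≡⟨ expand β⁻¹ (β I) T* ⟩
    (1ℚ + β⁻¹) * T* + β⁻¹ * β I * T*
      ≡⟨ cong (λ u → (1ℚ + β⁻¹) * T* + u * T*) (*-inverseˡ (β I)) ⟩
    (1ℚ + β⁻¹) * T* + 1ℚ * T*         ≡⟨ collect β⁻¹ T* ⟩
    (1ℚ + 1ℚ + β⁻¹) * T*
      ≤⟨ *-monoʳ-≤ 0≤T* (+-monoˡ-≤ β⁻¹ (p≤p+q {x = 1ℚ + 1ℚ} 0≤1)) ⟩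
    ratio I * T*                      ∎
  where
  open ≤-Reasoning
  instance
    β≢0 : NonZero (β I)
    β≢0 = pos⇒nonZero (β I) {{positive (β>0 I)}}
  β⁻¹ = 1/ β I
  0≤β⁻¹ : 0ℚ ≤ β⁻¹
  0≤β⁻¹ = <⇒≤ (positive⁻¹ β⁻¹ {{1/pos⇒pos (β I) {{positive (β>0 I)}}}})
  e≡β⁻¹[βe] : e ≡ β⁻¹ * (β I * e)
  e≡β⁻¹[βe] = trans (sym (*-identityˡ e))
    (trans (cong (_* e) (sym (*-inverseˡ (β I)))) (*-assoc β⁻¹ (β I) e))
  expand : ∀ u b t → t + u * ((1ℚ + b) * t) ≡ (1ℚ + u) * t + u * b * t
  expand = solve 3 (λ u b t →
    t :+ u :* ((con 1ℚ :+ b) :* t) := (con 1ℚ :+ u) :* t :+ u :* b :* t) refl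
  collect : ∀ u t → (1ℚ + u) * t + 1ℚ * t ≡ (1ℚ + 1ℚ + u) * t
  collect = solve 2 (λ u t →
    (con 1ℚ :+ u) :* t :+ con 1ℚ :* t := (con 1ℚ :+ con 1ℚ :+ u) :* t) refl

ECTF-upper-bound : (I : Instance) (s : Schedule I) → IsECTF I s →
  Feasible I s × ((σ : Schedule I) → Feasible I σ → makespan I s ≤ ratio I * makespan I σ)
ECTF-upper-bound I s (π , π-injective , starts , greedy) = s-feasible , s-bound
  where
  P = tabulate π
  P! : Unique P
  P! = Unique-tabulate⁺ π-injective

  every-job-in-P : ∀ z → z ∈ P
  every-job-in-P z with injective⇒surjective π-injective z
  ... | k , refl = ∈-tabulate⁺ k

  P-ECTF : Greedy I 0ℚ P × Sequential I s 0ℚ P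
  P-ECTF = tabulate-ECTF I π 0ℚ
    (λ k → trans (starts k) (cong (_⊔ r I (π k)) (availBefore≡availFrom _ π k)))
    (λ k k′ k≤k′ → subst (λ t → Γ I t (π k) ≤ Γ I t (π k′)) (availBefore≡availFrom _ π k)
                     (greedy k k′ k≤k′))

  s-feasible : Feasible I s
  s-feasible =
    ( (λ i → Sequential-release I (proj₂ P-ECTF) (every-job-in-P i))
    , (λ i j → Sequential-disjoint I (proj₂ P-ECTF) ≤-refl (every-job-in-P i) (every-job-in-P j)))

  s-bound : (σ : Schedule I) → Feasible I σ → makespan I s ≤ ratio I * makespan I σ
  s-bound σ σ-feasible =
    ≤-ratio I (0≤T* I σ σ-feasible) makespan≤T*+excess
      (excess-bound I σ σ-feasible P P! P P! ⊆-refl)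
    where
    open ≤-Reasoning
    T* = makespan I σ
    excessP = excess I σ σ-feasible P
    makespan≤T*+excess : makespan I s ≤ T* + excessP
    makespan≤T*+excess = begin
      makespan I s
        ≤⟨ maxFin-lub (finish-inflationary I P ≤-refl)
             (λ z → Sequential-finish I (proj₂ P-ECTF) ≤-refl (every-job-in-P z)) ⟩
      finish I 0ℚ P
        ≤⟨ finish-bound I σ σ-feasible P P! 0ℚ P P! ⊆-refl (proj₁ P-ECTF) ⟩
      (L I ^ length P * 0ℚ) ⊔ T* + excessP
        ≡⟨ cong (λ u → u ⊔ T* + excessP) (*-zeroʳ (L I ^ length P)) ⟩
      0ℚ ⊔ T* + excessP
        ≡⟨ cong (_+ excessP) (p≤q⇒p⊔q≡q (0≤T* I σ σ-feasible)) ⟩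
      T* + excessP ∎

-- Job 0 is released at 1 with α = 0, job 1 is released at 0 with α = L + β. At time 0
-- ECTF strictly prefers job 0 (it completes at L), then runs job 1 until L·L + L + β, whereas
-- running job 1 first gives makespan L (L + β). With β = (2 - ρ)/2 the difference between
-- the first makespan and ρ times the second is β²(3 + 4β) > 0.
ECTF-lower-bound : (ρ : ℚ) → ρ < 1ℚ + 1ℚ →
  Σ Instance λ I → Σ (Schedule I) λ s → Σ (Schedule I) λ σ →
    IsECTF I s × Feasible I σ × (ρ * makespan I σ < makespan I s)
ECTF-lower-bound ρ ρ<2 = I , s , σ , s-ECTF , σ-feasible , gap
  where
  d = ½ * (1ℚ + 1ℚ - ρ)
  l = 1ℚ + d
  a = l + d

  0<d : 0ℚ < d
  0<d = 0<p*q (positive⁻¹ ½) (subst (_< 1ℚ + 1ℚ - ρ) (+-inverseʳ ρ) (+-monoˡ-< (- ρ) ρ<2))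

  0≤d : 0ℚ ≤ d
  0≤d = <⇒≤ 0<d

  1≤l : 1ℚ ≤ l
  1≤l = p≤p+q 0≤d

  l≤a : l ≤ a
  l≤a = p≤p+q 0≤d

  0≤a : 0ℚ ≤ a
  0≤a = ≤-trans 0≤1 (≤-trans 1≤l l≤a)

  I : Instance
  I = record
    { n   = 2
    ; r   = λ { zero → 1ℚ  ; (suc zero) → 0ℚ }
    ; α   = λ { zero → 0ℚ  ; (suc zero) → a }
    ; β   = d
    ; r≥0 = λ { zero → 0≤1 ; (suc zero) → ≤-refl }
    ; α≥0 = λ { zero → ≤-refl ; (suc zero) → 0≤a }
    ; β>0 = 0<d
    }

  c₀ = l * 1ℚ + 0ℚ

  c₀≡l : c₀ ≡ l
  c₀≡l = trans (+-identityʳ (l * 1ℚ)) (*-identityʳ l)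

  l*0+a≡a : l * 0ℚ + a ≡ a
  l*0+a≡a = trans (cong (_+ a) (*-zeroʳ l)) (+-identityˡ a)

  s : Schedule I
  s zero       = 1ℚ
  s (suc zero) = c₀

  σ : Schedule I
  σ zero       = a
  σ (suc zero) = 0ℚ

  s-ECTF : IsECTF I s
  s-ECTF = id , id , starts , greedy
    where
    starts : ∀ k → s k ≡ availBefore 2 (completion I s) id k ⊔ r I k
    starts zero       = refl
    starts (suc zero) = sym (p≥q⇒p⊔q≡p (subst (0ℚ ≤_) (sym c₀≡l) (≤-trans 0≤1 1≤l)))

    greedy : ∀ k k′ → toℕ k ℕ.≤ toℕ k′ →
             Γ I (availBefore 2 (completion I s) id k) k ≤ Γ I (availBefore 2 (completion I s) id k) k′
    greedy zero       zero       _ = ≤-refl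
    greedy zero       (suc zero) _ = subst₂ _≤_ (sym c₀≡l) (sym l*0+a≡a) l≤a
    greedy (suc zero) (suc zero) _ = ≤-refl

  σ-feasible : Feasible I σ
  σ-feasible = release , disjoint
    where
    release : ∀ i → r I i ≤ σ i
    release zero       = ≤-trans 1≤l l≤a
    release (suc zero) = ≤-refl

    disjoint : ∀ i j → i ≢ j → completion I σ i ≤ σ j ⊎ completion I σ j ≤ σ i
    disjoint zero       zero       i≢j = ⊥-elim (i≢j refl)
    disjoint zero       (suc zero) _   = inj₂ (≤-reflexive l*0+a≡a)
    disjoint (suc zero) zero       _   = inj₁ (≤-reflexive l*0+a≡a)
    disjoint (suc zero) (suc zero) i≢j = ⊥-elim (i≢j refl)

  a≤l*a+0 : a ≤ l * a + 0ℚ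
  a≤l*a+0 = subst (a ≤_) (sym (+-identityʳ (l * a))) (p≤Lp I 0≤a)

  makespan-σ : makespan I σ ≡ l * a + 0ℚ
  makespan-σ = ≤-antisym
    (maxFin-lub {f = completion I σ} (≤-trans 0≤a a≤l*a+0)
      λ { zero → ≤-refl ; (suc zero) → ≤-trans (≤-reflexive l*0+a≡a) a≤l*a+0 })
    (maxFin-ub (completion I σ) zero)

  ρ≡2-2d : ρ ≡ 1ℚ + 1ℚ - (1ℚ + 1ℚ) * d
  ρ≡2-2d = solve 1 (λ ρ →
    ρ := con 1ℚ :+ con 1ℚ :- (con 1ℚ :+ con 1ℚ) :* (con ½ :* (con 1ℚ :+ con 1ℚ :- ρ))) refl ρ

  makespans : ∀ d → (1ℚ + d) * ((1ℚ + d) * 1ℚ + 0ℚ) + (1ℚ + d + d)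
    ≡ (1ℚ + 1ℚ - (1ℚ + 1ℚ) * d) * ((1ℚ + d) * (1ℚ + d + d) + 0ℚ)
      + d * d * (1ℚ + 1ℚ + 1ℚ + (1ℚ + 1ℚ + 1ℚ + 1ℚ) * d)
  makespans = solve 1 (λ d →
    (con 1ℚ :+ d) :* ((con 1ℚ :+ d) :* con 1ℚ :+ con 0ℚ) :+ (con 1ℚ :+ d :+ d)
      := (con 1ℚ :+ con 1ℚ :- (con 1ℚ :+ con 1ℚ) :* d)
           :* ((con 1ℚ :+ d) :* (con 1ℚ :+ d :+ d) :+ con 0ℚ)
         :+ d :* d :* (con 1ℚ :+ con 1ℚ :+ con 1ℚ :+ (con 1ℚ :+ con 1ℚ :+ con 1ℚ :+ con 1ℚ) :* d)) refl

  slack = d * d * (1ℚ + 1ℚ + 1ℚ + (1ℚ + 1ℚ + 1ℚ + 1ℚ) * d)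

  0<slack : 0ℚ < slack
  0<slack = 0<p*q (0<p*q 0<d 0<d) (<-≤-trans (positive⁻¹ (1ℚ + 1ℚ + 1ℚ))
    (p≤p+q (0≤p*q (nonNegative⁻¹ (1ℚ + 1ℚ + 1ℚ + 1ℚ)) 0≤d)))

  gap : ρ * makespan I σ < makespan I s
  gap = begin-strict
    ρ * makespan I σ
      ≡⟨ cong₂ _*_ ρ≡2-2d makespan-σ ⟩
    (1ℚ + 1ℚ - (1ℚ + 1ℚ) * d) * (l * a + 0ℚ)
      <⟨ p<p+q 0<slack ⟩
    (1ℚ + 1ℚ - (1ℚ + 1ℚ) * d) * (l * a + 0ℚ) + slack
      ≡⟨ makespans d ⟨
    completion I s (suc zero)
      ≤⟨ maxFin-ub (completion I s) (suc zero) ⟩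
    makespan I s ∎
    where open ≤-Reasoning

theorem15 :
  -- upper bound: every ECTF schedule is feasible and every ECTF schedule has makespan ≤ (3 + 1/β) · (makespan of any feasible schedule)
  ((I : Instance) (s : Schedule I) → IsECTF I s →
     Feasible I s ×
     ((σ : Schedule I) → Feasible I σ → makespan I s ≤ ratio I * makespan I σ))
  ×
  -- lower bound: ECTF is not ρ-approximate for any ρ < 2
  ((ρ : ℚ) → ρ < 1ℚ + 1ℚ →
     Σ Instance λ I → Σ (Schedule I) λ s → Σ (Schedule I) λ σ →
       IsECTF I s × Feasible I σ × (ρ * makespan I σ < makespan I s))
theorem15 = ECTF-upper-bound , ECTF-lower-bound
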